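{- Let $\mathcal{C}$, $H$, $G$, $J$ and $F_{\overrightarrow{ab}}$ be as in the context. For every object $A=p_{i_0}\ldots p_{i_{n-1}}$ of $\mathcal{C}$ we have $H(A)=\mathbf{p}_{i_0}\cdots\mathbf{p}_{i_{n-1}}$, and for every arrow $f\colon p_{i_0}\ldots p_{i_{n-1}}\to p_{j_0}\ldots p_{j_{m-1}}$ of $\mathcal{C}$, the relation $F_{\overrightarrow{ab}}(J(G f))$, for $\overrightarrow{ab}$ the sequence $\mathbf{p}_{i_0}\ldots\mathbf{p}_{i_{n-1}}\mathbf{p}_{j_0}\ldots\mathbf{p}_{j_{m-1}}$, is the graph of the function $H f$. That is, the functor $F\circ(J\circ G)_P$ (which sends $A$ to $\mathbf{p}_{i_0}\cdots\mathbf{p}_{i_{n-1}}$ and $f$ to $F_{\overrightarrow{ab}}(J(Gf))$), regarded as a functor into $\mathbf{Set}_\omega$, is equal to $H$.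
   Context: $\mathbf{Set}_\omega$ is the full subcategory of $\mathbf{Set}$ on the finite ordinals. Product structure on $\mathbf{Set}_\omega$: terminal object $1$, product $n\cdot m$, with $\iota(i,j)=i\cdot m+j$ the product of arrows is $f_1\cdot f_2=\iota\circ(f_1\times f_2)\circ\iota^{ -1}$, projections $\pi_k\circ\iota^{ -1}$, diagonal $\iota\circ\Delta$. Coproduct structure on $\mathbf{Set}_\omega$: initial object $0$, coproduct $n+m$, coproduct of $f\colon n\to m$, $f'\colon n'\to m'$ is $g\colon n+n'\to m+m'$ with $g(i)=f(i)$ for $i<n$ and $g(i)=m+f'(i-n)$ otherwise, injections $i\mapsto i$ and $j\mapsto n+j$, codiagonal $n+n\to n$ sending $i$ and $n+i$ to $i$; hence $\mathbf{Set}_\omega^{op}$ has finite strict monoidal products (product $+$, terminal object $0$). $\mathcal{C}$ is the category with finite strict monoidal products freely generated by $P=\{p_1,p_2,\dots\}$ (free object over $P$ in the category of categories with finite strict monoidal products and functors preserving this structure on the nose); its objects are finite sequences of elements of $P$. $H\colon\mathcal{C}\to\mathbf{Set}_\omega$ is the unique structure-preserving functor with $H(p_n)=\mathbf{p}_n$, the $n$-th prime; $G\colon\mathcal{C}\to\mathbf{Set}_\omega^{op}$ is the unique structure-preserving functor with $G(p_n)=1$ for all $n$ (so an object of length $n$ goes to $n$). $\mathit{Gen}$ has finite ordinals as objects and equivalence relations on $n+m$ as arrows $n\to m$; $J\colon\mathbf{Set}_\omega^{op}\to\mathit{Gen}$ is identity on objects and sends $f^{op}\colon n\to m$ (with $f\colon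 m\to n$) to the equivalence on $n+m$ with classes $\{i\}\cup\{j+n\mid f(j)=i\}$, $i\in n$. For $\overrightarrow{d}=d_0\ldots d_{k-1}$, $\iota_{\overrightarrow{d}}(i_0,\dots,i_{k-1})=\sum_l i_l\cdot d_{l+1}\cdots d_{k-1}$. For $R\colon n\to m$ in $\mathit{Gen}$ and a sequence $\overrightarrow{ab}=a_0\ldots a_{n-1}b_0\ldots b_{m-1}$ of finite ordinals $\ge2$, $F_{\overrightarrow{ab}}(R)$ is the set of $(i,j)\in(a_0\cdots a_{n-1})\times(b_0\cdots b_{m-1})$ such that the concatenation $\overrightarrow{c}$ of $\iota_{\overrightarrow{a}}^{ -1}(i)$ and $\iota_{\overrightarrow{b}}^{ -1}(j)$ satisfies $c_x=c_y$ for all $(x,y)\in R$. -}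

module Defs where

open import Data.Nat using (ℕ; zero; suc; _+_; _*_; _<_; _!)
open import Data.Nat.Primality using (prime?)

open import Data.Fin using (Fin; zero; suc; toℕ; splitAt; combine; remQuot)
open import Data.Sum using ([_,_]′)
open import Data.Product using (Σ; ∃; _×_; _,_; proj₁; proj₂)
open import Function using (_∘_; id)
open import Relation.Nullary using (yes; no)
open import Relation.Binary.PropositionalEquality using (_≡_; subst)

-- The n-th prime.  primeAt k is the (k+1)-th prime: primeAt 0 = 2,
-- primeAt 1 = 3, ...  (generator index k stands for p_{k+1}).

-- first prime in [s, s + fuel]  (fallback s is never reached below)
searchPrime : ℕ → ℕ → ℕ
searchPrime s zero = s
searchPrime s (suc fuel) with prime? s
... | yes _ = s
... | no  _ = searchPrime (suc s) fuel

-- least prime > p  (Euclid: a prime exists in (p, p! + 1])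
nextPrime : ℕ → ℕ
nextPrime p = searchPrime (suc p) (p !)

primeAt : ℕ → ℕ
primeAt zero    = 2
primeAt (suc k) = nextPrime (primeAt k)

prodF : ∀ {n} → (Fin n → ℕ) → ℕ
prodF {zero}  a = 1
prodF {suc n} a = a zero * prodF (a ∘ suc)

ιd : ∀ {n} → (Fin n → ℕ) → (Fin n → ℕ) → ℕ
ιd {zero}  d c = 0
ιd {suc n} d c = c zero * prodF (d ∘ suc) + ιd (d ∘ suc) (c ∘ suc)

-- The free category with finite strict monoidal products on P.
-- Objects: finite sequences of generators (index k ↦ p_{k+1}).
-- Arrows A → B: functions g : |B| → |A| with A_{g k} = B_k
-- (the k-th output component is the g k-th projection).

record Obj : Set where
  constructor obj
  field
    len : ℕ
    gen : Fin len → ℕ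
open Obj public

record Hom (A B : Obj) : Set where
  constructor hom
  field
    sel : Fin (len B) → Fin (len A)
    ok  : ∀ k → gen A (sel k) ≡ gen B k
open Hom public

-- Set_ω^op : an arrow n → m is (the opposite of) a function Fin m → Fin n

SetωOp[_,_] : ℕ → ℕ → Set
SetωOp[ n , m ] = Fin m → Fin n

-- G : C → Set_ω^op (each generator ↦ 1, so A ↦ len A)
G : ∀ {A B} → Hom A B → SetωOp[ len A , len B ]
G f = sel f

-- Gen : arrows n → m are (equivalence) relations on n + m

Gen[_,_] : ℕ → ℕ → Set₁
Gen[ n , m ] = Fin (n + m) → Fin (n + m) → Set

-- J (f^op) : classes {i} ∪ {j + n | f j = i}, i ∈ n
J : ∀ {n m} → SetωOp[ n , m ] → Gen[ n , m ]
J {n} f x y = cls x ≡ cls y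
  where
  cls : Fin (n + _) → Fin n
  cls z = [ id , f ]′ (splitAt n z)

-- F_{ab}(R) ⊆ (a_0⋯a_{n-1}) × (b_0⋯b_{m-1}); ι^{-1}(i) is the unique
-- in-range digit tuple c with ι_a c = i.
F : ∀ {n m} (a : Fin n → ℕ) (b : Fin m → ℕ) → Gen[ n , m ] →
    Fin (prodF a) → Fin (prodF b) → Set
F {n} {m} a b R i j =
  Σ (Fin n → ℕ) λ c → Σ (Fin m → ℕ) λ d →
    (∀ l → c l < a l) × (∀ l → d l < b l) ×
    ιd a c ≡ toℕ i × ιd b d ≡ toℕ j ×
    (∀ x y → R x y → [ c , d ]′ (splitAt n x) ≡ [ c , d ]′ (splitAt n y))

-- H : C → Set_ω, the structure preserving functor with p_k ↦ k-th prime,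
-- built from the product structure of Set_ω (ι (i , j) = i·m + j).

pseq : (A : Obj) → Fin (len A) → ℕ
pseq A k = primeAt (gen A k)

H₀ : Obj → ℕ
H₀ A = prodF (pseq A)

-- projection onto the l-th factor: π ∘ ι^{-1}, iterated
projF : ∀ {n} (a : Fin n → ℕ) (l : Fin n) → Fin (prodF a) → Fin (a l)
projF {suc n} a zero    x = proj₁ (remQuot {a zero} (prodF (a ∘ suc)) x)
projF {suc n} a (suc l) x = projF (a ∘ suc) l (proj₂ (remQuot {a zero} (prodF (a ∘ suc)) x))

-- tupling into a product: ι ∘ (h₀ × ⋯) ∘ diagonal
tupleF : ∀ {m} (b : Fin m → ℕ) → ((k : Fin m) → Fin (b k)) → Fin (prodF b)
tupleF {zero}  b h = zero
tupleF {suc m} b h = combine (h zero) (tupleF (b ∘ suc) (h ∘ suc))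

H₁ : ∀ {A B} → Hom A B → Fin (H₀ A) → Fin (H₀ B)
H₁ {A} {B} f x =
  tupleF (pseq B) (λ k → subst (λ i → Fin (primeAt i)) (ok f k)
                              (projF (pseq A) (sel f k) x))

{-# OPTIONS --safe #-}
module Submission where

-- H f acts on a tuple of digits of a mixed-radix numeral (in the radices p_{i_l}) by
-- reindexing along the selection map of f, while a pair (x , y) lies in F(J(G f))
-- exactly when the digits of y are those of x reindexed the same way.  Both sides
-- are therefore compared through digit expansions, using that a bounded digit tuple
-- is the unique expansion of its value ι_a.

open import Defs
open import Data.Nat using (ℕ; zero; suc; _+_; _*_; _<_)
open import Data.Nat.Properties using (*-comm)
open import Data.Fin using (Fin; zero; suc; toℕ; fromℕ<; splitAt; combine; remQuot; _↑ˡ_; _↑ʳ_)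
open import Data.Fin.Properties
  using (toℕ-injective; toℕ<n; toℕ-fromℕ<; toℕ-combine; remQuot-combine; combine-remQuot; splitAt-↑ˡ; splitAt-↑ʳ)
open import Data.Sum using (inj₁; inj₂; [_,_]′)
open import Data.Product using (_×_; _,_; proj₁; proj₂)
open import Function using (_∘_; id)
open import Function.Bundles using (_⇔_; mk⇔; Equivalence)
open import Relation.Binary.PropositionalEquality hiding (J)
open ≡-Reasoning

projF-tupleF : ∀ {n} (a : Fin n → ℕ) (h : (l : Fin n) → Fin (a l)) (l : Fin n) →
               projF a l (tupleF a h) ≡ h l
projF-tupleF a h zero    = cong proj₁ (remQuot-combine (h zero) _)
projF-tupleF a h (suc l) = begin
  projF (a ∘ suc) l (proj₂ (remQuot {a zero} (prodF (a ∘ suc)) (tupleF a h)))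
    ≡⟨ cong (projF (a ∘ suc) l ∘ proj₂) (remQuot-combine (h zero) _) ⟩
  projF (a ∘ suc) l (tupleF (a ∘ suc) (h ∘ suc))
    ≡⟨ projF-tupleF (a ∘ suc) (h ∘ suc) l ⟩
  h (suc l) ∎

tupleF-projF : ∀ {n} (a : Fin n → ℕ) (x : Fin (prodF a)) → tupleF a (λ l → projF a l x) ≡ x
tupleF-projF {zero}  a zero = refl
tupleF-projF {suc n} a x = begin
  combine q (tupleF (a ∘ suc) (λ l → projF (a ∘ suc) l r)) ≡⟨ cong (combine q) (tupleF-projF (a ∘ suc) r) ⟩
  combine q r                                              ≡⟨ combine-remQuot {a zero} (prodF (a ∘ suc)) x ⟩
  x                                                        ∎
  where
  q : Fin (a zero)
  q = proj₁ (remQuot {a zero} (prodF (a ∘ suc)) x)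
  r : Fin (prodF (a ∘ suc))
  r = proj₂ (remQuot {a zero} (prodF (a ∘ suc)) x)

ιd-cong : ∀ {n} (a : Fin n → ℕ) {c d : Fin n → ℕ} → (∀ l → c l ≡ d l) → ιd a c ≡ ιd a d
ιd-cong {zero}  a c≗d = refl
ιd-cong {suc n} a c≗d = cong₂ _+_ (cong (_* prodF (a ∘ suc)) (c≗d zero)) (ιd-cong (a ∘ suc) (c≗d ∘ suc))

toℕ-tupleF : ∀ {n} (a : Fin n → ℕ) (h : (l : Fin n) → Fin (a l)) → toℕ (tupleF a h) ≡ ιd a (λ l → toℕ (h l))
toℕ-tupleF {zero}  a h = refl
toℕ-tupleF {suc n} a h = trans (toℕ-combine (h zero) _)
  (cong₂ _+_ (*-comm _ (toℕ (h zero))) (toℕ-tupleF (a ∘ suc) (h ∘ suc)))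

digits : ∀ {n} (a : Fin n → ℕ) → Fin (prodF a) → Fin n → ℕ
digits a x l = toℕ (projF a l x)

digits<radix : ∀ {n} (a : Fin n → ℕ) (x : Fin (prodF a)) (l : Fin n) → digits a x l < a l
digits<radix a x l = toℕ<n (projF a l x)

ιd-digits : ∀ {n} (a : Fin n → ℕ) (x : Fin (prodF a)) → ιd a (digits a x) ≡ toℕ x
ιd-digits a x = trans (sym (toℕ-tupleF a (λ l → projF a l x))) (cong toℕ (tupleF-projF a x))

ιd≡toℕ⇒digits : ∀ {n} (a : Fin n → ℕ) {c : Fin n → ℕ} (x : Fin (prodF a)) →
                (∀ l → c l < a l) → ιd a c ≡ toℕ x → ∀ l → c l ≡ digits a x l
ιd≡toℕ⇒digits a {c} x c<a ιc≡x l = begin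
  c l                           ≡⟨ sym (toℕ-fromℕ< (c<a l)) ⟩
  toℕ (fromℕ< (c<a l))          ≡⟨ cong toℕ (sym (projF-tupleF a c′ l)) ⟩
  toℕ (projF a l (tupleF a c′)) ≡⟨ cong (toℕ ∘ projF a l) tupleF-c′≡x ⟩
  digits a x l                  ∎
  where
  c′ : (l : Fin _) → Fin (a l)
  c′ l = fromℕ< (c<a l)
  tupleF-c′≡x : tupleF a c′ ≡ x
  tupleF-c′≡x = toℕ-injective (begin
    toℕ (tupleF a c′)         ≡⟨ toℕ-tupleF a c′ ⟩
    ιd a (λ l → toℕ (c′ l))   ≡⟨ ιd-cong a (λ l → toℕ-fromℕ< (c<a l)) ⟩
    ιd a c                    ≡⟨ ιc≡x ⟩
    toℕ x                     ∎)

toℕ-subst : ∀ {I : Set} (P : I → ℕ) {i j : I} (i≡j : i ≡ j) (v : Fin (P i)) →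
            toℕ (subst (Fin ∘ P) i≡j v) ≡ toℕ v
toℕ-subst P refl v = refl

toℕ-H₁ : ∀ {A B} (f : Hom A B) (x : Fin (H₀ A)) →
         toℕ (H₁ f x) ≡ ιd (pseq B) (digits (pseq A) x ∘ sel f)
toℕ-H₁ {A} {B} f x = trans (toℕ-tupleF (pseq B) _) (ιd-cong (pseq B) (λ k → toℕ-subst primeAt (ok f k) _))

module _ {n m : ℕ} (c : Fin n → ℕ) (d : Fin m → ℕ) where

  Respects : Gen[ n , m ] → Set
  Respects R = ∀ u v → R u v → [ c , d ]′ (splitAt n u) ≡ [ c , d ]′ (splitAt n v)

  respects-J⇔ : (s : Fin m → Fin n) → Respects (J s) ⇔ (∀ k → c (s k) ≡ d k)
  respects-J⇔ s = mk⇔ to from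
    where
    to : Respects (J s) → ∀ k → c (s k) ≡ d k
    to resp k = begin
      c (s k)                           ≡⟨ cong [ c , d ]′ (sym (splitAt-↑ˡ n (s k) m)) ⟩
      [ c , d ]′ (splitAt n (s k ↑ˡ m)) ≡⟨ resp _ _ same-class ⟩
      [ c , d ]′ (splitAt n (n ↑ʳ k))   ≡⟨ cong [ c , d ]′ (splitAt-↑ʳ n m k) ⟩
      d k                               ∎
      where
      same-class : J s (s k ↑ˡ m) (n ↑ʳ k)
      same-class = trans (cong [ id , s ]′ (splitAt-↑ˡ n (s k) m)) (sym (cong [ id , s ]′ (splitAt-↑ʳ n m k)))

    from : (∀ k → c (s k) ≡ d k) → Respects (J s)
    from c∘s≗d u v same-class = trans (via-class u) (trans (cong c same-class) (sym (via-class v)))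
      where
      via-class : ∀ z → [ c , d ]′ (splitAt n z) ≡ c ([ id , s ]′ (splitAt n z))
      via-class z with splitAt n z
      ... | inj₁ i = refl
      ... | inj₂ k = sym (c∘s≗d k)

F-J-graph : ∀ {A B} (f : Hom A B) (x : Fin (H₀ A)) (y : Fin (H₀ B)) →
            F (pseq A) (pseq B) (J (G f)) x y ⇔ (H₁ f x ≡ y)
F-J-graph {A} {B} f x y = mk⇔ to from
  where
  a : Fin (len A) → ℕ
  a = pseq A
  b : Fin (len B) → ℕ
  b = pseq B

  to : F a b (J (G f)) x y → H₁ f x ≡ y
  to (c , d , c<a , _ , ιc≡x , ιd≡y , resp) = toℕ-injective (begin
    toℕ (H₁ f x)                ≡⟨ toℕ-H₁ f x ⟩
    ιd b (digits a x ∘ sel f)   ≡⟨ ιd-cong b (λ k → sym (ιd≡toℕ⇒digits a x c<a ιc≡x (sel f k))) ⟩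
    ιd b (c ∘ sel f)            ≡⟨ ιd-cong b (Equivalence.to (respects-J⇔ c d (sel f)) resp) ⟩
    ιd b d                      ≡⟨ ιd≡y ⟩
    toℕ y                       ∎)

  from : H₁ f x ≡ y → F a b (J (G f)) x y
  from refl =
    digits a x , digits a x ∘ sel f ,
    digits<radix a x ,
    (λ k → subst (λ i → digits a x (sel f k) < primeAt i) (ok f k) (digits<radix a x (sel f k))) ,
    ιd-digits a x , sym (toℕ-H₁ f x) ,
    Equivalence.from (respects-J⇔ (digits a x) (digits a x ∘ sel f) (sel f)) (λ k → refl)

lemma7 : ((A : Obj) → H₀ A ≡ prodF (λ k → primeAt (gen A k)))
       × ((A B : Obj) (f : Hom A B) (x : Fin (H₀ A)) (y : Fin (H₀ B)) →
            F (pseq A) (pseq B) (J (G f)) x y ⇔ (H₁ f x ≡ y))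
lemma7 = (λ A → refl) , (λ A B → F-J-graph)
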